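{- Let $m \geq 2$ and $n>4$. With $S=\begin{pmatrix} 0 & -1 \\ 1 & 0\end{pmatrix}$ and $T=\begin{pmatrix} 1 & 1 \\ 0 & 1\end{pmatrix}$ (viewed in $SL_2(\mathbb{Z}/2^m\mathbb{Z})$), \begin{itemize} \item $\left|\Delta_{n}^{Id}(m)\right|=\left|\Delta_{n}^{ -Id}(m)\right|=\frac{2^{mn-n-3m}(2^{n+1}+8 \times (-1)^{n+1})}{3}$; \item $\left|\Delta_{n}^{S}(m)\right|=\left|\Delta_{n}^{ -S}(m)\right|=\frac{2^{mn-n-3m+1}(2^{n}+(-1)^{n}\times 8)}{3}$; \item $\left|\Delta_{n}^{T}(m)\right|=\left|\Delta_{n}^{ -T}(m)\right|=\frac{2^{mn-n-3m}(2^{n+1}+8 \times (-1)^{n+1})}{3}$. \end{itemize}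
   Context: For $a_1,\ldots,a_k$ in a commutative unitary ring, $M_{k}(a_1,\ldots,a_k):=\begin{pmatrix} a_{k} & -1 \\ 1 & 0\end{pmatrix}\cdots\begin{pmatrix} a_{1} & -1 \\ 1 & 0\end{pmatrix}$. For $B \in SL_{2}(\mathbb{Z}/2^{m}\mathbb{Z})$, $\Delta_{k}^{B}(m):=\{(a_{1},\ldots,a_{k}) \in (\mathbb{Z}/2^{m}\mathbb{Z})^{k}:~M_{k}(a_{1},\ldots,a_{k})=B \text{ and } a_{2} \text{ is invertible in } \mathbb{Z}/2^m\mathbb{Z}\}$. -}

module Defs where

open import Data.Nat as ℕ using (ℕ; zero; suc; NonZero; nonZero)
open import Data.Nat.Properties using (m^n≢0)
open import Data.Nat.DivMod using (_mod_)
open import Data.Fin using (Fin; toℕ; fromℕ<)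
open import Data.Fin.Properties using (any?) renaming (_≟_ to _≟F_)
open import Data.Product using (Σ; ∃; _×_; _,_)
open import Data.Product.Properties using (≡-dec)
open import Data.Vec using (Vec; []; _∷_)
open import Data.List using (allFin; List; []; _∷_; map; concatMap; filter; length)
open import Data.List.Base using ([_])
open import Data.Empty using (⊥)
open import Relation.Nullary using (Dec; yes; no)
open import Relation.Nullary.Decidable using (_×-dec_)
open import Relation.Binary.PropositionalEquality using (_≡_; refl)

2^m-nonZero : ∀ {m : ℕ} → NonZero (2 ℕ.^ m)
2^m-nonZero {m} = m^n≢0 2 m ⦃ nonZero ⦄

record Zmod (m : ℕ) : Set where
  constructor ⟦_⟧
  field val : Fin (2 ℕ.^ m)
open Zmod public

_≟Z_ : ∀ {m} (a b : Zmod m) → Dec (a ≡ b)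
⟦ x ⟧ ≟Z ⟦ y ⟧ with x ≟F y
... | yes refl = yes refl
... | no x≢y = no λ { refl → x≢y refl }

module _ {m : ℕ} where
  red : ℕ → Zmod m
  red x = ⟦ _mod_ x (2 ℕ.^ m) ⦃ 2^m-nonZero {m} ⦄ ⟧

  infixl 6 _+ₘ_
  infixl 7 _*ₘ_

  _+ₘ_ : Zmod m → Zmod m → Zmod m
  a +ₘ b = red (toℕ (val a) ℕ.+ toℕ (val b))

  _*ₘ_ : Zmod m → Zmod m → Zmod m
  a *ₘ b = red (toℕ (val a) ℕ.* toℕ (val b))

  -ₘ_ : Zmod m → Zmod m
  -ₘ a = red (2 ℕ.^ m ℕ.∸ toℕ (val a))

  0ₘ 1ₘ : Zmod m
  0ₘ = red 0
  1ₘ = red 1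

  Invertible : Zmod m → Set
  Invertible a = ∃ λ b → a *ₘ b ≡ 1ₘ

  invertible? : (a : Zmod m) → Dec (Invertible a)
  invertible? a with any? (λ b → (a *ₘ ⟦ b ⟧) ≟Z 1ₘ)
  ... | yes (b , p) = yes (⟦ b ⟧ , p)
  ... | no ¬p = no λ { (⟦ b ⟧ , p) → ¬p (b , p) }

  -- 2×2 matrices over ℤ/2^m ℤ: (a , b , c , d) is the matrix [[a , b] , [c , d]]
  Mat : Set
  Mat = Zmod m × Zmod m × Zmod m × Zmod m

  _≟M_ : (A B : Mat) → Dec (A ≡ B)
  _≟M_ = ≡-dec _≟Z_ (≡-dec _≟Z_ (≡-dec _≟Z_ _≟Z_))

  infixl 7 _·_
  _·_ : Mat → Mat → Mat
  (a , b , c , d) · (e , f , g , h) =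
    (a *ₘ e +ₘ b *ₘ g , a *ₘ f +ₘ b *ₘ h , c *ₘ e +ₘ d *ₘ g , c *ₘ f +ₘ d *ₘ h)

  negM : Mat → Mat
  negM (a , b , c , d) = (-ₘ a , -ₘ b , -ₘ c , -ₘ d)

  Id S T : Mat
  Id = (1ₘ , 0ₘ , 0ₘ , 1ₘ)
  S  = (0ₘ , -ₘ 1ₘ , 1ₘ , 0ₘ)
  T  = (1ₘ , 1ₘ , 0ₘ , 1ₘ)

  elem : Zmod m → Mat
  elem a = (a , -ₘ 1ₘ , 1ₘ , 0ₘ)

  Macc : ∀ {k} → Mat → Vec (Zmod m) k → Mat
  Macc acc [] = acc
  Macc acc (a ∷ as) = Macc (elem a · acc) as

  -- M_k(a_1,…,a_k) = elem a_k · … · elem a_1, with the vector listing a_1 first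
  Mk : ∀ {k} → Vec (Zmod m) k → Mat
  Mk = Macc Id

  A2Invertible : ∀ {k} → Vec (Zmod m) k → Set
  A2Invertible (a₁ ∷ a₂ ∷ _) = Invertible a₂
  A2Invertible _ = ⊥

  a2invertible? : ∀ {k} → (v : Vec (Zmod m) k) → Dec (A2Invertible v)
  a2invertible? (a₁ ∷ a₂ ∷ _) = invertible? a₂
  a2invertible? [] = no λ ()
  a2invertible? (_ ∷ []) = no λ ()

  InΔ : ∀ {k} → Mat → Vec (Zmod m) k → Set
  InΔ B v = (Mk v ≡ B) × A2Invertible v

  inΔ? : ∀ {k} (B : Mat) (v : Vec (Zmod m) k) → Dec (InΔ B v)
  inΔ? B v = (Mk v ≟M B) ×-dec a2invertible? v

  allZ : List (Zmod m)
  allZ = map ⟦_⟧ (allFin (2 ℕ.^ m))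

  allVecs : (k : ℕ) → List (Vec (Zmod m) k)
  allVecs zero = [ [] ]
  allVecs (suc k) = concatMap (λ x → map (x ∷_) (allVecs k)) allZ

cardΔ : (m k : ℕ) → Mat {m} → ℕ
cardΔ m k B = length (filter (inΔ? B) (allVecs {m} k))

{-# OPTIONS --safe #-}
-- Split a word as u ++ v with u = (a₁ , a₂ , a₃).  Then M(u ++ v) = M(v) · M(u), so u ++ v
-- lies in Δ^B exactly when M(u) = E with E = adj (M v) · B.  Since M(x , y , z) has (2,2)
-- entry -y and det E = 1, this has a solution with y a unit iff E₂₂ is a unit, i.e. odd,
-- and then exactly one.  The parity of E₂₂ only depends on the parities of B's second
-- column and of the first column of M(v), and the latter evolve through the letters of v
-- by a three-state automaton over 𝔽₂.  So |Δ_n^B| = 2^((m-1)(n-3)) · W, where W counts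
-- the parity words of length n - 3 ending in an odd corner; W satisfies a linear
-- recurrence with solution (2^(n-2) + α (-1)^(n-3)) / 3, α = 1 for ±Id and ±T and
-- α = -2 for ±S.
module Submission where

open import Defs
open import Algebra.Bundles using (CommutativeRing)
open import Algebra.Consequences.Propositional
  using (comm∧idˡ⇒id; comm∧invʳ⇒inv; comm∧distrʳ⇒distrˡ)
import Algebra.Properties.Ring as RingProperties
import Algebra.Solver.Ring
import Algebra.Solver.Ring.AlmostCommutativeRing as ACR
open import Algebra.Structures using (IsCommutativeRing)
open import Data.Bool using (true; false; if_then_else_)
open import Data.Fin using (toℕ)
open import Data.Fin.Properties using (toℕ-fromℕ<; toℕ-injective; toℕ<n)
open import Data.Integer as ℤ using (ℤ; +_; -[1+_]; _⊖_; -_; _+_; _*_; _^_)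
import Data.Integer.Properties as ℤ
open import Data.Integer.Tactic.RingSolver using (solve-∀)
open import Data.List as List using (List; []; _∷_; length; filter; concatMap)
import Data.List.Properties as List
open import Data.List.Membership.Propositional using (_∈_)
open import Data.List.Membership.Propositional.Properties using (∈-map⁺; ∈-allFin)
open import Data.List.Relation.Unary.All as All using (All; []; _∷_)
open import Data.List.Relation.Unary.Any using (here; there)
open import Data.List.Relation.Unary.Unique.Propositional using (Unique; []; _∷_)
open import Data.List.Relation.Unary.Unique.Propositional.Properties as UniqueProperties
  using (allFin⁺)
open import Data.Maybe as Maybe using (Maybe)
open import Data.Nat using (ℕ; zero; suc; NonZero; _%_; _/_; _≤_; _<_; s≤s; parity)
import Data.Nat as ℕ
open import Data.Nat.Coprimality using (Coprime; coprime-Bézout; coprime-divisor)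
open import Data.Nat.DivMod
  using (m≡m%n+[m/n]*n; m<n⇒m%n≡m; %-distribˡ-+; %-distribˡ-*; m*n%n≡0)
open import Data.Nat.Divisibility using (_∣_; divides; ∣1⇒≡1; ∣-trans)
open import Data.Nat.GCD using (module Bézout)
open import Data.Nat.ListAction using (sum)
open import Data.Nat.ListAction.Properties using (sum-++)
open import Data.Nat.Primality using (irreducible[2])
import Data.Nat.Properties as ℕ
open import Data.Nat.Tactic.RingSolver using () renaming (solve-∀ to ℕ-solve-∀)
open import Data.Parity.Base as ℙ using (Parity; 0ℙ; 1ℙ)
import Data.Parity.Properties as ℙ
open import Data.Parity.Properties using (+-homo-+; *-homo-*)
open import Data.Product using (Σ; _×_; _,_; proj₁; proj₂)
open import Data.Sign as Sign using (Sign)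
open import Data.Sum using (inj₁; inj₂)
open import Data.Vec as Vec using (Vec; []; _∷_; _++_)
import Data.Vec.Properties as Vec
open import Function using (_∘_; id)
open import Function.Bundles using (_⇔_; mk⇔)
open import Level using (0ℓ)
open import Relation.Binary.PropositionalEquality
open import Relation.Nullary using (¬_; contradiction; Dec; yes; no; does; dec⇒maybe)
open import Relation.Nullary.Decidable using (does-⇔; dec-true; dec-false)

open import Algebra.Properties.CommutativeSemigroup ℕ.+-commutativeSemigroup
  using () renaming (interchange to +-interchange)

module ℙRing = RingProperties ℙ.+-*-ring

-- ℤ/2^m ℤ is a commutative ring

module _ {m : ℕ} where

  private instance
    2^m≢0 : NonZero (2 ℕ.^ m)
    2^m≢0 = 2^m-nonZero {m}

  toℕₘ : Zmod m → ℕ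
  toℕₘ a = toℕ (val a)

  toℕₘ-red : ∀ x → toℕₘ (red {m} x) ≡ x % 2 ℕ.^ m
  toℕₘ-red x = toℕ-fromℕ< _

  red-toℕₘ : ∀ a → red (toℕₘ a) ≡ a
  red-toℕₘ ⟦ i ⟧ = cong ⟦_⟧ (toℕ-injective (trans (toℕ-fromℕ< _) (m<n⇒m%n≡m (toℕ<n i))))

  red-cong-% : ∀ {x y} → x % 2 ℕ.^ m ≡ y % 2 ℕ.^ m → red {m} x ≡ red y
  red-cong-% eq = cong ⟦_⟧ (toℕ-injective (trans (toℕ-fromℕ< _) (trans eq (sym (toℕ-fromℕ< _)))))

  red-+ : ∀ x y → red {m} (x ℕ.+ y) ≡ red x +ₘ red y
  red-+ x y = red-cong-% (trans (%-distribˡ-+ x y _)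
    (sym (cong₂ (λ a b → (a ℕ.+ b) % _) (toℕₘ-red x) (toℕₘ-red y))))

  red-* : ∀ x y → red {m} (x ℕ.* y) ≡ red x *ₘ red y
  red-* x y = red-cong-% (trans (%-distribˡ-* x y _)
    (sym (cong₂ (λ a b → (a ℕ.* b) % _) (toℕₘ-red x) (toℕₘ-red y))))

  red-*2^m : ∀ k → red {m} (k ℕ.* 2 ℕ.^ m) ≡ 0ₘ
  red-*2^m k = red-cong-% (trans (m*n%n≡0 k _) (sym (m<n⇒m%n≡m (ℕ.>-nonZero⁻¹ _))))

  *ₘ-red : ∀ a x → a *ₘ red {m} x ≡ red (x ℕ.* toℕₘ a)
  *ₘ-red a x = begin
    a *ₘ red x                ≡⟨ cong (_*ₘ red x) (red-toℕₘ a) ⟨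
    red (toℕₘ a) *ₘ red x     ≡⟨ red-* (toℕₘ a) x ⟨
    red (toℕₘ a ℕ.* x)        ≡⟨ cong red (ℕ.*-comm (toℕₘ a) x) ⟩
    red (x ℕ.* toℕₘ a)        ∎
    where open ≡-Reasoning

  red-elim : (P : Zmod m → Set) → (∀ x → P (red x)) → ∀ a → P a
  red-elim P P-red a = subst P (red-toℕₘ a) (P-red (toℕₘ a))

  +ₘ-comm : ∀ (a b : Zmod m) → a +ₘ b ≡ b +ₘ a
  +ₘ-comm a b = cong red (ℕ.+-comm (toℕₘ a) (toℕₘ b))

  *ₘ-comm : ∀ (a b : Zmod m) → a *ₘ b ≡ b *ₘ a
  *ₘ-comm a b = cong red (ℕ.*-comm (toℕₘ a) (toℕₘ b))

  +ₘ-assoc : ∀ (a b c : Zmod m) → (a +ₘ b) +ₘ c ≡ a +ₘ (b +ₘ c)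
  +ₘ-assoc = red-elim _ λ x → red-elim _ λ y → red-elim _ λ z → begin
    (red x +ₘ red y) +ₘ red z ≡⟨ cong (_+ₘ red z) (red-+ x y) ⟨
    red (x ℕ.+ y) +ₘ red z    ≡⟨ red-+ (x ℕ.+ y) z ⟨
    red (x ℕ.+ y ℕ.+ z)       ≡⟨ cong red (ℕ.+-assoc x y z) ⟩
    red (x ℕ.+ (y ℕ.+ z))     ≡⟨ red-+ x (y ℕ.+ z) ⟩
    red x +ₘ red (y ℕ.+ z)    ≡⟨ cong (red x +ₘ_) (red-+ y z) ⟩
    red x +ₘ (red y +ₘ red z) ∎
    where open ≡-Reasoning

  *ₘ-assoc : ∀ (a b c : Zmod m) → (a *ₘ b) *ₘ c ≡ a *ₘ (b *ₘ c)
  *ₘ-assoc = red-elim _ λ x → red-elim _ λ y → red-elim _ λ z → begin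
    (red x *ₘ red y) *ₘ red z ≡⟨ cong (_*ₘ red z) (red-* x y) ⟨
    red (x ℕ.* y) *ₘ red z    ≡⟨ red-* (x ℕ.* y) z ⟨
    red (x ℕ.* y ℕ.* z)       ≡⟨ cong red (ℕ.*-assoc x y z) ⟩
    red (x ℕ.* (y ℕ.* z))     ≡⟨ red-* x (y ℕ.* z) ⟩
    red x *ₘ red (y ℕ.* z)    ≡⟨ cong (red x *ₘ_) (red-* y z) ⟩
    red x *ₘ (red y *ₘ red z) ∎
    where open ≡-Reasoning

  *ₘ-distribʳ-+ₘ : ∀ (a b c : Zmod m) → (b +ₘ c) *ₘ a ≡ b *ₘ a +ₘ c *ₘ a
  *ₘ-distribʳ-+ₘ = red-elim _ λ x → red-elim _ λ y → red-elim _ λ z → begin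
    (red y +ₘ red z) *ₘ red x         ≡⟨ cong (_*ₘ red x) (red-+ y z) ⟨
    red (y ℕ.+ z) *ₘ red x            ≡⟨ red-* (y ℕ.+ z) x ⟨
    red ((y ℕ.+ z) ℕ.* x)             ≡⟨ cong red (ℕ.*-distribʳ-+ x y z) ⟩
    red (y ℕ.* x ℕ.+ z ℕ.* x)         ≡⟨ red-+ (y ℕ.* x) (z ℕ.* x) ⟩
    red (y ℕ.* x) +ₘ red (z ℕ.* x)    ≡⟨ cong₂ _+ₘ_ (red-* y x) (red-* z x) ⟩
    red y *ₘ red x +ₘ red z *ₘ red x ∎
    where open ≡-Reasoning

  +ₘ-identityˡ : ∀ (a : Zmod m) → 0ₘ +ₘ a ≡ a
  +ₘ-identityˡ = red-elim _ λ x → sym (red-+ 0 x)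

  +ₘ-identityʳ : ∀ (a : Zmod m) → a +ₘ 0ₘ ≡ a
  +ₘ-identityʳ a = trans (+ₘ-comm a 0ₘ) (+ₘ-identityˡ a)

  *ₘ-identityˡ : ∀ (a : Zmod m) → 1ₘ *ₘ a ≡ a
  *ₘ-identityˡ = red-elim _ λ x → trans (sym (red-* 1 x)) (cong red (ℕ.*-identityˡ x))

  -ₘ-inverseʳ : ∀ (a : Zmod m) → a +ₘ -ₘ a ≡ 0ₘ
  -ₘ-inverseʳ a = begin
    a +ₘ -ₘ a                                   ≡⟨ cong (_+ₘ -ₘ a) (red-toℕₘ a) ⟨
    red (toℕₘ a) +ₘ red (2 ℕ.^ m ℕ.∸ toℕₘ a)    ≡⟨ red-+ (toℕₘ a) _ ⟨
    red (toℕₘ a ℕ.+ (2 ℕ.^ m ℕ.∸ toℕₘ a))       ≡⟨ cong red (ℕ.m+[n∸m]≡n (ℕ.<⇒≤ (toℕ<n (val a)))) ⟩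
    red (2 ℕ.^ m)                               ≡⟨ cong red (ℕ.+-identityʳ _) ⟨
    red (1 ℕ.* 2 ℕ.^ m)                         ≡⟨ red-*2^m 1 ⟩
    0ₘ                                          ∎
    where open ≡-Reasoning

  +ₘ-*ₘ-isCommutativeRing : IsCommutativeRing _≡_ _+ₘ_ _*ₘ_ -ₘ_ (0ₘ {m}) 1ₘ
  +ₘ-*ₘ-isCommutativeRing = record
    { isRing = record
      { +-isAbelianGroup = record
        { isGroup = record
          { isMonoid = record
            { isSemigroup = record
              { isMagma = record { isEquivalence = isEquivalence ; ∙-cong = cong₂ _+ₘ_ }
              ; assoc = +ₘ-assoc }
            ; identity = comm∧idˡ⇒id +ₘ-comm +ₘ-identityˡ }
          ; inverse = comm∧invʳ⇒inv +ₘ-comm -ₘ-inverseʳ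
          ; ⁻¹-cong = cong -ₘ_ }
        ; comm = +ₘ-comm }
      ; *-cong = cong₂ _*ₘ_
      ; *-assoc = *ₘ-assoc
      ; *-identity = comm∧idˡ⇒id *ₘ-comm *ₘ-identityˡ
      ; distrib = comm∧distrʳ⇒distrˡ *ₘ-comm *ₘ-distribʳ-+ₘ , *ₘ-distribʳ-+ₘ }
    ; *-comm = *ₘ-comm }

+ₘ-*ₘ-commutativeRing : ℕ → CommutativeRing 0ℓ 0ℓ
+ₘ-*ₘ-commutativeRing m = record { isCommutativeRing = +ₘ-*ₘ-isCommutativeRing {m} }

module _ {m : ℕ} where

  open RingProperties (CommutativeRing.ring (+ₘ-*ₘ-commutativeRing m)) public
    using ( -‿involutive; -‿distribˡ-*; -‿distribʳ-*; -0#≈0#; -‿anti-homo-+; -‿injective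
          ; +-cancelˡ; +-cancelʳ; +-inverseʳ-unique; //-rightDividesʳ; ⁻¹-anti-homo-//)

  infixl 6 _-ₘ_
  _-ₘ_ : Zmod m → Zmod m → Zmod m
  a -ₘ b = a +ₘ -ₘ b

  -ₘ-+ₘ : ∀ (a b : Zmod m) → -ₘ (a +ₘ b) ≡ -ₘ a +ₘ -ₘ b
  -ₘ-+ₘ a b = trans (-‿anti-homo-+ a b) (+ₘ-comm (-ₘ b) (-ₘ a))

  red-∸ : ∀ {a b} → b ≤ a → red {m} (a ℕ.∸ b) ≡ red a -ₘ red b
  red-∸ {a} {b} b≤a = begin
    red (a ℕ.∸ b)                   ≡⟨ //-rightDividesʳ (red b) _ ⟨
    red (a ℕ.∸ b) +ₘ red b -ₘ red b ≡⟨ cong (_-ₘ red b) (red-+ (a ℕ.∸ b) b) ⟨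
    red (a ℕ.∸ b ℕ.+ b) -ₘ red b    ≡⟨ cong (λ c → red c -ₘ red b) (ℕ.m∸n+n≡m b≤a) ⟩
    red a -ₘ red b                  ∎
    where open ≡-Reasoning

  fromℤ : ℤ → Zmod m
  fromℤ (+ n)    = red n
  fromℤ -[1+ n ] = -ₘ red (suc n)

  fromℤ-neg : ∀ i → fromℤ (ℤ.- i) ≡ -ₘ fromℤ i
  fromℤ-neg (+ zero)  = sym -0#≈0#
  fromℤ-neg (+ suc n) = refl
  fromℤ-neg -[1+ n ]  = sym (-‿involutive (red (suc n)))

  fromℤ-⊖ : ∀ a b → fromℤ (a ⊖ b) ≡ red a -ₘ red b
  fromℤ-⊖ a b with ℕ.≤-<-connex b a
  ... | inj₁ b≤a = trans (cong fromℤ (ℤ.⊖-≥ b≤a)) (red-∸ b≤a)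
  ... | inj₂ a<b = begin
    fromℤ (a ⊖ b)                ≡⟨ cong fromℤ (ℤ.⊖-< a<b) ⟩
    fromℤ (ℤ.- (+ (b ℕ.∸ a)))    ≡⟨ fromℤ-neg (+ (b ℕ.∸ a)) ⟩
    -ₘ red (b ℕ.∸ a)             ≡⟨ cong -ₘ_ (red-∸ (ℕ.<⇒≤ a<b)) ⟩
    -ₘ (red b -ₘ red a)          ≡⟨ ⁻¹-anti-homo-// (red b) (red a) ⟩
    red a -ₘ red b               ∎
    where open ≡-Reasoning

  fromℤ-+ : ∀ i j → fromℤ (i ℤ.+ j) ≡ fromℤ i +ₘ fromℤ j
  fromℤ-+ (+ a)    (+ b)    = red-+ a b
  fromℤ-+ (+ a)    -[1+ b ] = fromℤ-⊖ a (suc b)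
  fromℤ-+ -[1+ a ] (+ b)    = trans (fromℤ-⊖ b (suc a)) (+ₘ-comm (red b) _)
  fromℤ-+ -[1+ a ] -[1+ b ] = begin
    -ₘ red (suc (suc (a ℕ.+ b)))          ≡⟨ cong (λ c → -ₘ red (suc c)) (ℕ.+-suc a b) ⟨
    -ₘ red (suc a ℕ.+ suc b)              ≡⟨ cong -ₘ_ (red-+ (suc a) (suc b)) ⟩
    -ₘ (red (suc a) +ₘ red (suc b))       ≡⟨ -ₘ-+ₘ (red (suc a)) (red (suc b)) ⟩
    -ₘ red (suc a) +ₘ -ₘ red (suc b)      ∎
    where open ≡-Reasoning

  -ₘ-*ₘ-ₘ : ∀ (a b : Zmod m) → -ₘ a *ₘ -ₘ b ≡ a *ₘ b
  -ₘ-*ₘ-ₘ a b = begin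
    -ₘ a *ₘ -ₘ b     ≡⟨ -‿distribʳ-* (-ₘ a) b ⟨
    -ₘ (-ₘ a *ₘ b)   ≡⟨ cong -ₘ_ (-‿distribˡ-* a b) ⟨
    -ₘ -ₘ (a *ₘ b)   ≡⟨ -‿involutive (a *ₘ b) ⟩
    a *ₘ b           ∎
    where open ≡-Reasoning

  signed : Sign → Zmod m → Zmod m
  signed Sign.+ a = a
  signed Sign.- a = -ₘ a

  fromℤ-◃ : ∀ s n → fromℤ (s ℤ.◃ n) ≡ signed s (red n)
  fromℤ-◃ Sign.+ zero    = refl
  fromℤ-◃ Sign.- zero    = sym -0#≈0#
  fromℤ-◃ Sign.+ (suc n) = refl
  fromℤ-◃ Sign.- (suc n) = refl

  signed-*ₘ : ∀ s t (a b : Zmod m) → signed (s Sign.* t) (a *ₘ b) ≡ signed s a *ₘ signed t b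
  signed-*ₘ Sign.+ Sign.+ a b = refl
  signed-*ₘ Sign.+ Sign.- a b = -‿distribʳ-* a b
  signed-*ₘ Sign.- Sign.+ a b = -‿distribˡ-* a b
  signed-*ₘ Sign.- Sign.- a b = sym (-ₘ-*ₘ-ₘ a b)

  fromℤ-signed : ∀ i → fromℤ i ≡ signed (ℤ.sign i) (red ℤ.∣ i ∣)
  fromℤ-signed (+ n)    = refl
  fromℤ-signed -[1+ n ] = refl

  fromℤ-* : ∀ i j → fromℤ (i ℤ.* j) ≡ fromℤ i *ₘ fromℤ j
  fromℤ-* i j = begin
    fromℤ (ℤ.sign i Sign.* ℤ.sign j ℤ.◃ ℤ.∣ i ∣ ℕ.* ℤ.∣ j ∣)
      ≡⟨ fromℤ-◃ (ℤ.sign i Sign.* ℤ.sign j) _ ⟩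
    signed (ℤ.sign i Sign.* ℤ.sign j) (red (ℤ.∣ i ∣ ℕ.* ℤ.∣ j ∣))
      ≡⟨ cong (signed _) (red-* ℤ.∣ i ∣ ℤ.∣ j ∣) ⟩
    signed (ℤ.sign i Sign.* ℤ.sign j) (red ℤ.∣ i ∣ *ₘ red ℤ.∣ j ∣)
      ≡⟨ signed-*ₘ (ℤ.sign i) (ℤ.sign j) _ _ ⟩
    signed (ℤ.sign i) (red ℤ.∣ i ∣) *ₘ signed (ℤ.sign j) (red ℤ.∣ j ∣)
      ≡⟨ cong₂ _*ₘ_ (fromℤ-signed i) (fromℤ-signed j) ⟨
    fromℤ i *ₘ fromℤ j
      ∎
    where open ≡-Reasoning

  fromℤ-morphism : ℤ.+-*-rawRing ACR.-Raw-AlmostCommutative⟶ ACR.fromCommutativeRing (+ₘ-*ₘ-commutativeRing m)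
  fromℤ-morphism = record
    { ⟦_⟧ = fromℤ ; +-homo = fromℤ-+ ; *-homo = fromℤ-* ; -‿homo = fromℤ-neg ; 0-homo = refl ; 1-homo = refl }

  -- Coefficients live in ℤ, where normalisation computes although m is a variable.
  fromℤ-≟ : ∀ i j → Maybe (fromℤ i ≡ fromℤ j)
  fromℤ-≟ i j = Maybe.map (cong fromℤ) (dec⇒maybe (i ℤ.≟ j))

  open Algebra.Solver.Ring ℤ.+-*-rawRing (ACR.fromCommutativeRing (+ₘ-*ₘ-commutativeRing m))
    fromℤ-morphism fromℤ-≟ public
    using (solve; _:+_; _:*_; _:-_; :-_; con; _:=_)

-- Matrices

module _ {m : ℕ} where

  mat-≡ : ∀ {a b c d a′ b′ c′ d′ : Zmod m} → a ≡ a′ → b ≡ b′ → c ≡ c′ → d ≡ d′ →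
          _≡_ {A = Mat} (a , b , c , d) (a′ , b′ , c′ , d′)
  mat-≡ refl refl refl refl = refl

  ·-assoc : ∀ (A B C : Mat {m}) → (A · B) · C ≡ A · (B · C)
  ·-assoc (a , b , c , d) (e , f , g , h) (i , j , k , l) =
    mat-≡ (row a b e f g h i k) (row a b e f g h j l) (row c d e f g h i k) (row c d e f g h j l)
    where
    row : ∀ (a b e f g h i k : Zmod m) →
          (a *ₘ e +ₘ b *ₘ g) *ₘ i +ₘ (a *ₘ f +ₘ b *ₘ h) *ₘ k ≡
          a *ₘ (e *ₘ i +ₘ f *ₘ k) +ₘ b *ₘ (g *ₘ i +ₘ h *ₘ k)
    row = solve 8 (λ a b e f g h i k → (a :* e :+ b :* g) :* i :+ (a :* f :+ b :* h) :* k
                                     := a :* (e :* i :+ f :* k) :+ b :* (g :* i :+ h :* k)) refl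

  ·-identityˡ : ∀ (A : Mat {m}) → Id · A ≡ A
  ·-identityˡ (a , b , c , d) = mat-≡ (first a c) (first b d) (second a c) (second b d)
    where
    first : ∀ (a c : Zmod m) → 1ₘ *ₘ a +ₘ 0ₘ *ₘ c ≡ a
    first = solve 2 (λ a c → con (+ 1) :* a :+ con (+ 0) :* c := a) refl
    second : ∀ (a c : Zmod m) → 0ₘ *ₘ a +ₘ 1ₘ *ₘ c ≡ c
    second = solve 2 (λ a c → con (+ 0) :* a :+ con (+ 1) :* c := c) refl

  ·-identityʳ : ∀ (A : Mat {m}) → A · Id ≡ A
  ·-identityʳ (a , b , c , d) = mat-≡ (first a b) (second a b) (first c d) (second c d)
    where
    first : ∀ (a b : Zmod m) → a *ₘ 1ₘ +ₘ b *ₘ 0ₘ ≡ a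
    first = solve 2 (λ a b → a :* con (+ 1) :+ b :* con (+ 0) := a) refl
    second : ∀ (a b : Zmod m) → a *ₘ 0ₘ +ₘ b *ₘ 1ₘ ≡ b
    second = solve 2 (λ a b → a :* con (+ 0) :+ b :* con (+ 1) := b) refl

  elem-· : ∀ (a p q r s : Zmod m) → elem a · (p , q , r , s) ≡ (a *ₘ p -ₘ r , a *ₘ q -ₘ s , p , q)
  elem-· a p q r s = mat-≡ (shift a p r) (shift a q s) (keep p r) (keep q s)
    where
    shift : ∀ (a p r : Zmod m) → a *ₘ p +ₘ -ₘ 1ₘ *ₘ r ≡ a *ₘ p -ₘ r
    shift = solve 3 (λ a p r → a :* p :+ (:- con (+ 1)) :* r := a :* p :- r) refl
    keep : ∀ (p r : Zmod m) → 1ₘ *ₘ p +ₘ 0ₘ *ₘ r ≡ p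
    keep = solve 2 (λ p r → con (+ 1) :* p :+ con (+ 0) :* r := p) refl

  det : Mat {m} → Zmod m
  det (a , b , c , d) = a *ₘ d -ₘ b *ₘ c

  adj : Mat {m} → Mat
  adj (a , b , c , d) = (d , -ₘ b , -ₘ c , a)

  det-· : ∀ (A B : Mat {m}) → det (A · B) ≡ det A *ₘ det B
  det-· (a , b , c , d) (e , f , g , h) = solve 8 (λ a b c d e f g h →
      (a :* e :+ b :* g) :* (c :* f :+ d :* h) :- (a :* f :+ b :* h) :* (c :* e :+ d :* g)
      := (a :* d :- b :* c) :* (e :* h :- f :* g)) refl a b c d e f g h

  det-adj : ∀ (A : Mat {m}) → det (adj A) ≡ det A
  det-adj (a , b , c , d) =
    solve 4 (λ a b c d → d :* a :- (:- b) :* (:- c) := a :* d :- b :* c) refl a b c d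

  det-Id : det (Id {m}) ≡ 1ₘ
  det-Id = solve 0 (con (+ 1) :* con (+ 1) :- con (+ 0) :* con (+ 0) := con (+ 1)) refl

  det-elem : ∀ (a : Zmod m) → det (elem a) ≡ 1ₘ
  det-elem = solve 1 (λ a → a :* con (+ 0) :- (:- con (+ 1)) :* con (+ 1) := con (+ 1)) refl

  adj-involutive : ∀ (A : Mat {m}) → adj (adj A) ≡ A
  adj-involutive (a , b , c , d) = mat-≡ refl (-‿involutive b) (-‿involutive c) refl

  adj-inverseˡ : ∀ (A : Mat {m}) → det A ≡ 1ₘ → adj A · A ≡ Id
  adj-inverseˡ (a , b , c , d) det≡1 =
    mat-≡ (trans (diagonal₁ a b c d) det≡1) (cancel₁ b d) (cancel₂ a c) (trans (diagonal₂ a b c d) det≡1)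
    where
    diagonal₁ : ∀ (a b c d : Zmod m) → d *ₘ a +ₘ -ₘ b *ₘ c ≡ a *ₘ d -ₘ b *ₘ c
    diagonal₁ = solve 4 (λ a b c d → d :* a :+ (:- b) :* c := a :* d :- b :* c) refl
    diagonal₂ : ∀ (a b c d : Zmod m) → -ₘ c *ₘ b +ₘ a *ₘ d ≡ a *ₘ d -ₘ b *ₘ c
    diagonal₂ = solve 4 (λ a b c d → (:- c) :* b :+ a :* d := a :* d :- b :* c) refl
    cancel₁ : ∀ (b d : Zmod m) → d *ₘ b +ₘ -ₘ b *ₘ d ≡ 0ₘ
    cancel₁ = solve 2 (λ b d → d :* b :+ (:- b) :* d := con (+ 0)) refl
    cancel₂ : ∀ (a c : Zmod m) → -ₘ c *ₘ a +ₘ a *ₘ c ≡ 0ₘ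
    cancel₂ = solve 2 (λ a c → (:- c) :* a :+ a :* c := con (+ 0)) refl

  adj-inverseʳ : ∀ (A : Mat {m}) → det A ≡ 1ₘ → A · adj A ≡ Id
  adj-inverseʳ A det≡1 = begin
    A · adj A             ≡⟨ cong (_· adj A) (adj-involutive A) ⟨
    adj (adj A) · adj A   ≡⟨ adj-inverseˡ (adj A) (trans (det-adj A) det≡1) ⟩
    Id                    ∎
    where open ≡-Reasoning

  Macc-· : ∀ {k} (P A : Mat {m}) (v : Vec (Zmod m) k) → Macc (P · A) v ≡ Macc P v · A
  Macc-· P A []      = refl
  Macc-· P A (a ∷ v) = trans (cong (λ X → Macc X v) (sym (·-assoc (elem a) P A))) (Macc-· (elem a · P) A v)

  Macc≡Mk· : ∀ {k} (A : Mat {m}) (v : Vec (Zmod m) k) → Macc A v ≡ Mk v · A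
  Macc≡Mk· A v = trans (cong (λ X → Macc X v) (sym (·-identityˡ A))) (Macc-· Id A v)

  Mk-++ : ∀ {j k} (u : Vec (Zmod m) j) (v : Vec (Zmod m) k) → Mk (u ++ v) ≡ Mk v · Mk u
  Mk-++ u v = trans (Macc-++ Id u v) (Macc≡Mk· (Mk u) v)
    where
    Macc-++ : ∀ {j k} (A : Mat {m}) (u : Vec (Zmod m) j) (v : Vec (Zmod m) k) → Macc A (u ++ v) ≡ Macc (Macc A u) v
    Macc-++ A []      v = refl
    Macc-++ A (a ∷ u) v = Macc-++ (elem a · A) u v

  det-Macc : ∀ {k} (A : Mat {m}) (v : Vec (Zmod m) k) → det (Macc A v) ≡ det A
  det-Macc A []      = refl
  det-Macc A (a ∷ v) = begin
    det (Macc (elem a · A) v)  ≡⟨ det-Macc (elem a · A) v ⟩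
    det (elem a · A)           ≡⟨ det-· (elem a) A ⟩
    det (elem a) *ₘ det A      ≡⟨ cong (_*ₘ det A) (det-elem a) ⟩
    1ₘ *ₘ det A                ≡⟨ *ₘ-identityˡ (det A) ⟩
    det A                      ∎
    where open ≡-Reasoning

  det-Mk : ∀ {k} (v : Vec (Zmod m) k) → det (Mk v) ≡ 1ₘ
  det-Mk v = trans (det-Macc Id v) det-Id

  ·-solveʳ : ∀ (C : Mat {m}) {X B} → det C ≡ 1ₘ → C · X ≡ B → X ≡ adj C · B
  ·-solveʳ C {X} {B} det≡1 C·X≡B = begin
    X                ≡⟨ ·-identityˡ X ⟨
    Id · X           ≡⟨ cong (_· X) (adj-inverseˡ C det≡1) ⟨
    (adj C · C) · X  ≡⟨ ·-assoc (adj C) C X ⟩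
    adj C · (C · X)  ≡⟨ cong (adj C ·_) C·X≡B ⟩
    adj C · B        ∎
    where open ≡-Reasoning

  ·-adj-cancel : ∀ (C B : Mat {m}) → det C ≡ 1ₘ → C · (adj C · B) ≡ B
  ·-adj-cancel C B det≡1 = begin
    C · (adj C · B)  ≡⟨ ·-assoc C (adj C) B ⟨
    (C · adj C) · B  ≡⟨ cong (_· B) (adj-inverseʳ C det≡1) ⟩
    Id · B           ≡⟨ ·-identityˡ B ⟩
    B                ∎
    where open ≡-Reasoning

  InΔ-++ : ∀ {j k} (B : Mat {m}) (u : Vec (Zmod m) (suc (suc j))) (v : Vec (Zmod m) k) →
           InΔ B (u ++ v) ⇔ InΔ (adj (Mk v) · B) u
  InΔ-++ B u@(_ ∷ _ ∷ _) v = mk⇔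
    (λ (Mk≡B , inv) → ·-solveʳ (Mk v) (det-Mk v) (trans (sym (Mk-++ u v)) Mk≡B) , inv)
    (λ (Mk≡adj·B , inv) →
       trans (Mk-++ u v) (trans (cong (Mk v ·_) Mk≡adj·B) (·-adj-cancel (Mk v) B (det-Mk v))) , inv)

  mat-≡⁻¹ : ∀ {a b c d a′ b′ c′ d′ : Zmod m} →
            _≡_ {A = Mat} (a , b , c , d) (a′ , b′ , c′ , d′) →
            a ≡ a′ × b ≡ b′ × c ≡ c′ × d ≡ d′
  mat-≡⁻¹ refl = refl , refl , refl , refl

  inverse-cancelˡ : ∀ (a b c : Zmod m) → a *ₘ b ≡ 1ₘ → a *ₘ (b *ₘ c) ≡ c
  inverse-cancelˡ a b c ab≡1 = begin
    a *ₘ (b *ₘ c)  ≡⟨ *ₘ-assoc a b c ⟨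
    a *ₘ b *ₘ c    ≡⟨ cong (_*ₘ c) ab≡1 ⟩
    1ₘ *ₘ c        ≡⟨ *ₘ-identityˡ c ⟩
    c              ∎
    where open ≡-Reasoning

  *ₘ-cancelˡ-invertible : ∀ (a b c : Zmod m) → Invertible a → a *ₘ b ≡ a *ₘ c → b ≡ c
  *ₘ-cancelˡ-invertible a b c (a⁻¹ , aa⁻¹≡1) ab≡ac = begin
    b                    ≡⟨ inverse-cancelˡ a⁻¹ a b a⁻¹a≡1 ⟨
    a⁻¹ *ₘ (a *ₘ b)      ≡⟨ cong (a⁻¹ *ₘ_) ab≡ac ⟩
    a⁻¹ *ₘ (a *ₘ c)      ≡⟨ inverse-cancelˡ a⁻¹ a c a⁻¹a≡1 ⟩
    c                    ∎
    where
    open ≡-Reasoning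
    a⁻¹a≡1 : a⁻¹ *ₘ a ≡ 1ₘ
    a⁻¹a≡1 = trans (*ₘ-comm a⁻¹ a) aa⁻¹≡1

  -ₘ-invertible : ∀ (a : Zmod m) → Invertible a → Invertible (-ₘ a)
  -ₘ-invertible a (a⁻¹ , aa⁻¹≡1) = -ₘ a⁻¹ , trans (-ₘ-*ₘ-ₘ a a⁻¹) aa⁻¹≡1

  det-cancel₁₁ : ∀ (a a′ b c d : Zmod m) → Invertible d →
                 det (a , b , c , d) ≡ det (a′ , b , c , d) → a ≡ a′
  det-cancel₁₁ a a′ b c d d-inv det≡det = *ₘ-cancelˡ-invertible d a a′ d-inv (begin
    d *ₘ a   ≡⟨ *ₘ-comm d a ⟩
    a *ₘ d   ≡⟨ +-cancelʳ (-ₘ (b *ₘ c)) (a *ₘ d) (a′ *ₘ d) det≡det ⟩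
    a′ *ₘ d  ≡⟨ *ₘ-comm a′ d ⟩
    d *ₘ a′  ∎)
    where open ≡-Reasoning

  Mk₃ : ∀ (x y z : Zmod m) →
        Mk (x ∷ y ∷ z ∷ []) ≡ (z *ₘ (y *ₘ x -ₘ 1ₘ) -ₘ x , 1ₘ -ₘ z *ₘ y , y *ₘ x -ₘ 1ₘ , -ₘ y)
  Mk₃ x y z = begin
    elem z · (elem y · (elem x · Id))
      ≡⟨ cong (λ A → elem z · (elem y · A)) (·-identityʳ (elem x)) ⟩
    elem z · (elem y · elem x)
      ≡⟨ cong (elem z ·_) (elem-· y x (-ₘ 1ₘ) 1ₘ 0ₘ) ⟩
    elem z · (y *ₘ x -ₘ 1ₘ , y *ₘ -ₘ 1ₘ -ₘ 0ₘ , x , -ₘ 1ₘ)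
      ≡⟨ elem-· z (y *ₘ x -ₘ 1ₘ) (y *ₘ -ₘ 1ₘ -ₘ 0ₘ) x (-ₘ 1ₘ) ⟩
    (z *ₘ (y *ₘ x -ₘ 1ₘ) -ₘ x , z *ₘ (y *ₘ -ₘ 1ₘ -ₘ 0ₘ) -ₘ -ₘ 1ₘ , y *ₘ x -ₘ 1ₘ , y *ₘ -ₘ 1ₘ -ₘ 0ₘ)
      ≡⟨ mat-≡ refl (entry₁₂ y z) refl (entry₂₂ y) ⟩
    (z *ₘ (y *ₘ x -ₘ 1ₘ) -ₘ x , 1ₘ -ₘ z *ₘ y , y *ₘ x -ₘ 1ₘ , -ₘ y)
      ∎
    where
    open ≡-Reasoning
    entry₁₂ : ∀ (y z : Zmod m) → z *ₘ (y *ₘ -ₘ 1ₘ -ₘ 0ₘ) -ₘ -ₘ 1ₘ ≡ 1ₘ -ₘ z *ₘ y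
    entry₁₂ = solve 2 (λ y z → z :* (y :* (:- con (+ 1)) :- con (+ 0)) :- (:- con (+ 1)) := con (+ 1) :- z :* y) refl
    entry₂₂ : ∀ (y : Zmod m) → y *ₘ -ₘ 1ₘ -ₘ 0ₘ ≡ -ₘ y
    entry₂₂ = solve 1 (λ y → y :* (:- con (+ 1)) :- con (+ 0) := :- y) refl

  Mk₃-injective : ∀ (x y z x′ y′ z′ : Zmod m) → Invertible y →
                  Mk (x ∷ y ∷ z ∷ []) ≡ Mk (x′ ∷ y′ ∷ z′ ∷ []) →
                  _≡_ {A = Vec (Zmod m) 3} (x ∷ y ∷ z ∷ []) (x′ ∷ y′ ∷ z′ ∷ [])
  Mk₃-injective x y z x′ y′ z′ y-inv Mk≡Mk′ = cong₂ _∷_ x≡x′ (cong₂ _∷_ y≡y′ (cong (_∷ []) z≡z′))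
    where
    open ≡-Reasoning
    entries : z *ₘ (y *ₘ x -ₘ 1ₘ) -ₘ x ≡ z′ *ₘ (y′ *ₘ x′ -ₘ 1ₘ) -ₘ x′
            × 1ₘ -ₘ z *ₘ y ≡ 1ₘ -ₘ z′ *ₘ y′
            × y *ₘ x -ₘ 1ₘ ≡ y′ *ₘ x′ -ₘ 1ₘ
            × -ₘ y ≡ -ₘ y′
    entries = mat-≡⁻¹ (trans (sym (Mk₃ x y z)) (trans Mk≡Mk′ (Mk₃ x′ y′ z′)))
    y≡y′ : y ≡ y′
    y≡y′ = -‿injective (proj₂ (proj₂ (proj₂ entries)))
    x≡x′ : x ≡ x′
    x≡x′ = *ₘ-cancelˡ-invertible y x x′ y-inv (begin
      y *ₘ x    ≡⟨ +-cancelʳ (-ₘ 1ₘ) (y *ₘ x) (y′ *ₘ x′) (proj₁ (proj₂ (proj₂ entries))) ⟩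
      y′ *ₘ x′  ≡⟨ cong (_*ₘ x′) y≡y′ ⟨
      y *ₘ x′   ∎)
    z≡z′ : z ≡ z′
    z≡z′ = *ₘ-cancelˡ-invertible y z z′ y-inv (begin
      y *ₘ z    ≡⟨ *ₘ-comm y z ⟩
      z *ₘ y    ≡⟨ -‿injective (+-cancelˡ 1ₘ _ _ (proj₁ (proj₂ entries))) ⟩
      z′ *ₘ y′  ≡⟨ cong (z′ *ₘ_) y≡y′ ⟨
      z′ *ₘ y   ≡⟨ *ₘ-comm z′ y ⟩
      y *ₘ z′   ∎)

  Mk₃-surjective : ∀ (e₁₁ e₁₂ e₂₁ e₂₂ : Zmod m) → det (e₁₁ , e₁₂ , e₂₁ , e₂₂) ≡ 1ₘ →
                   Invertible e₂₂ →
                   Σ (Vec (Zmod m) 3) (InΔ (e₁₁ , e₁₂ , e₂₁ , e₂₂))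
  Mk₃-surjective e₁₁ e₁₂ e₂₁ e₂₂ det≡1 e₂₂-inv@(w , e₂₂w≡1) =
    x₀ ∷ y₀ ∷ z₀ ∷ [] , trans Mk₀≡ (mat-≡ a₀≡e₁₁ refl refl refl) , -ₘ-invertible e₂₂ e₂₂-inv
    where
    -- y₀ is forced by the (2,2) entry, x₀ and z₀ by the (2,1) and (1,2) entries;
    -- the (1,1) entry then follows from det = 1.
    y₀ x₀ z₀ a₀ : Zmod m
    y₀ = -ₘ e₂₂
    x₀ = -ₘ w *ₘ (e₂₁ +ₘ 1ₘ)
    z₀ = -ₘ w *ₘ (1ₘ -ₘ e₁₂)
    a₀ = z₀ *ₘ (y₀ *ₘ x₀ -ₘ 1ₘ) -ₘ x₀
    y₀w≡1 : y₀ *ₘ -ₘ w ≡ 1ₘ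
    y₀w≡1 = trans (-ₘ-*ₘ-ₘ e₂₂ w) e₂₂w≡1
    1-[1-a]≡a : ∀ (a : Zmod m) → 1ₘ -ₘ (1ₘ -ₘ a) ≡ a
    1-[1-a]≡a = solve 1 (λ a → con (+ 1) :- (con (+ 1) :- a) := a) refl
    entry₁₂ : 1ₘ -ₘ z₀ *ₘ y₀ ≡ e₁₂
    entry₁₂ = begin
      1ₘ -ₘ z₀ *ₘ y₀           ≡⟨ cong (λ b → 1ₘ -ₘ b) (*ₘ-comm z₀ y₀) ⟩
      1ₘ -ₘ y₀ *ₘ z₀           ≡⟨ cong (λ b → 1ₘ -ₘ b) (inverse-cancelˡ y₀ (-ₘ w) (1ₘ -ₘ e₁₂) y₀w≡1) ⟩
      1ₘ -ₘ (1ₘ -ₘ e₁₂)        ≡⟨ 1-[1-a]≡a e₁₂ ⟩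
      e₁₂                      ∎
      where open ≡-Reasoning
    entry₂₁ : y₀ *ₘ x₀ -ₘ 1ₘ ≡ e₂₁
    entry₂₁ = begin
      y₀ *ₘ x₀ -ₘ 1ₘ           ≡⟨ cong (_-ₘ 1ₘ) (inverse-cancelˡ y₀ (-ₘ w) (e₂₁ +ₘ 1ₘ) y₀w≡1) ⟩
      e₂₁ +ₘ 1ₘ -ₘ 1ₘ          ≡⟨ //-rightDividesʳ 1ₘ e₂₁ ⟩
      e₂₁                      ∎
      where open ≡-Reasoning
    Mk₀≡ : Mk (x₀ ∷ y₀ ∷ z₀ ∷ []) ≡ (a₀ , e₁₂ , e₂₁ , e₂₂)
    Mk₀≡ = trans (Mk₃ x₀ y₀ z₀) (mat-≡ refl entry₁₂ entry₂₁ (-‿involutive e₂₂))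
    a₀≡e₁₁ : a₀ ≡ e₁₁
    a₀≡e₁₁ = det-cancel₁₁ a₀ e₁₁ e₁₂ e₂₁ e₂₂ e₂₂-inv (begin
      det (a₀ , e₁₂ , e₂₁ , e₂₂)          ≡⟨ cong det Mk₀≡ ⟨
      det (Mk (x₀ ∷ y₀ ∷ z₀ ∷ []))       ≡⟨ det-Mk (x₀ ∷ y₀ ∷ z₀ ∷ []) ⟩
      1ₘ                                 ≡⟨ det≡1 ⟨
      det (e₁₁ , e₁₂ , e₂₁ , e₂₂)        ∎)
      where open ≡-Reasoning

-- Sums

indicator : ∀ {P : Set} → Dec P → ℕ
indicator P? = if does P? then 1 else 0

indicator-⇔ : ∀ {P Q : Set} → P ⇔ Q → (P? : Dec P) (Q? : Dec Q) → indicator P? ≡ indicator Q?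
indicator-⇔ P⇔Q P? Q? = cong (λ b → if b then 1 else 0) (does-⇔ P⇔Q P? Q?)

module _ {A : Set} where

  sumBy : (A → ℕ) → List A → ℕ
  sumBy f xs = sum (List.map f xs)

  sumBy-cong : ∀ {f g : A → ℕ} (xs : List A) → (∀ x → f x ≡ g x) → sumBy f xs ≡ sumBy g xs
  sumBy-cong xs f≗g = cong sum (List.map-cong f≗g xs)

  sumBy-zero : ∀ {f : A → ℕ} {xs} → All (λ x → f x ≡ 0) xs → sumBy f xs ≡ 0
  sumBy-zero []             = refl
  sumBy-zero (fx≡0 ∷ f≡0s) = cong₂ ℕ._+_ fx≡0 (sumBy-zero f≡0s)

  sumBy-+ : ∀ (f g : A → ℕ) xs → sumBy (λ x → f x ℕ.+ g x) xs ≡ sumBy f xs ℕ.+ sumBy g xs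
  sumBy-+ f g []       = refl
  sumBy-+ f g (x ∷ xs) = trans (cong (f x ℕ.+ g x ℕ.+_) (sumBy-+ f g xs))
                               (+-interchange (f x) (g x) (sumBy f xs) (sumBy g xs))

  sumBy-unique : ∀ {f : A → ℕ} {x₀ xs} → Unique xs → x₀ ∈ xs → (∀ x → x ≢ x₀ → f x ≡ 0) →
                 sumBy f xs ≡ f x₀
  sumBy-unique (x₀∉xs ∷ _) (here refl) f≡0 =
    trans (cong (_ ℕ.+_) (sumBy-zero (All.map (λ x₀≢x → f≡0 _ (x₀≢x ∘ sym)) x₀∉xs))) (ℕ.+-identityʳ _)
  sumBy-unique (x∉xs ∷ xs-unique) (there x₀∈xs) f≡0 =
    cong₂ ℕ._+_ (f≡0 _ (All.lookup x∉xs x₀∈xs)) (sumBy-unique xs-unique x₀∈xs f≡0)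

  length-filter : ∀ {P : A → Set} (P? : ∀ x → Dec (P x)) xs → length (filter P? xs) ≡ sumBy (indicator ∘ P?) xs
  length-filter P? []       = refl
  length-filter P? (x ∷ xs) with does (P? x)
  ... | true  = cong suc (length-filter P? xs)
  ... | false = length-filter P? xs

module _ {A B : Set} where

  sumBy-map : ∀ (f : B → ℕ) (g : A → B) xs → sumBy f (List.map g xs) ≡ sumBy (f ∘ g) xs
  sumBy-map f g xs = cong sum (sym (List.map-∘ xs))

  sumBy-concatMap : ∀ (f : B → ℕ) (g : A → List B) xs →
                    sumBy f (concatMap g xs) ≡ sumBy (λ x → sumBy f (g x)) xs
  sumBy-concatMap f g []       = refl
  sumBy-concatMap f g (x ∷ xs) = begin
    sum (List.map f (g x List.++ concatMap g xs))                 ≡⟨ cong sum (List.map-++ f (g x) _) ⟩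
    sum (List.map f (g x) List.++ List.map f (concatMap g xs))    ≡⟨ sum-++ (List.map f (g x)) _ ⟩
    sumBy f (g x) ℕ.+ sumBy f (concatMap g xs)
      ≡⟨ cong (sumBy f (g x) ℕ.+_) (sumBy-concatMap f g xs) ⟩
    sumBy f (g x) ℕ.+ sumBy (λ x → sumBy f (g x)) xs         ∎
    where open ≡-Reasoning

  sumBy-swap : ∀ (f : A → B → ℕ) xs ys →
               sumBy (λ x → sumBy (f x) ys) xs ≡ sumBy (λ y → sumBy (λ x → f x y) xs) ys
  sumBy-swap f []       ys = sym (sumBy-zero (All.universal (λ _ → refl) ys))
  sumBy-swap f (x ∷ xs) ys = trans (cong (sumBy (f x) ys ℕ.+_) (sumBy-swap f xs ys))
                                   (sym (sumBy-+ (f x) (λ y → sumBy (λ x → f x y) xs) ys))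

indicator-yes : ∀ {P : Set} (P? : Dec P) → P → indicator P? ≡ 1
indicator-yes P? p = cong (λ b → if b then 1 else 0) (dec-true P? p)

indicator-no : ∀ {P : Set} (P? : Dec P) → ¬ P → indicator P? ≡ 0
indicator-no P? ¬p = cong (λ b → if b then 1 else 0) (dec-false P? ¬p)

module _ {m : ℕ} where

  sumVec : (k : ℕ) → (Vec (Zmod m) k → ℕ) → ℕ
  sumVec k f = sumBy f (allVecs k)

  sumVec-cong : ∀ k {f g : Vec (Zmod m) k → ℕ} → (∀ v → f v ≡ g v) → sumVec k f ≡ sumVec k g
  sumVec-cong k = sumBy-cong (allVecs k)

  sumVec-suc : ∀ k (f : Vec (Zmod m) (suc k) → ℕ) →
               sumVec (suc k) f ≡ sumBy (λ a → sumVec k (f ∘ (a ∷_))) allZ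
  sumVec-suc k f = trans (sumBy-concatMap f (λ a → List.map (a ∷_) (allVecs k)) allZ)
                         (sumBy-cong allZ (λ a → sumBy-map f (a ∷_) (allVecs k)))

  sumVec-++ : ∀ j k (f : Vec (Zmod m) (j ℕ.+ k) → ℕ) →
              sumVec (j ℕ.+ k) f ≡ sumVec k (λ v → sumVec j (λ u → f (u ++ v)))
  sumVec-++ zero    k f = sumVec-cong k (λ v → sym (ℕ.+-identityʳ (f v)))
  sumVec-++ (suc j) k f = begin
    sumVec (suc j ℕ.+ k) f
      ≡⟨ sumVec-suc (j ℕ.+ k) f ⟩
    sumBy (λ a → sumVec (j ℕ.+ k) (f ∘ (a ∷_))) allZ
      ≡⟨ sumBy-cong allZ (λ a → sumVec-++ j k (f ∘ (a ∷_))) ⟩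
    sumBy (λ a → sumVec k (λ v → sumVec j (λ u → f (a ∷ u ++ v)))) allZ
      ≡⟨ sumBy-swap (λ a v → sumVec j (λ u → f (a ∷ u ++ v))) allZ (allVecs k) ⟩
    sumVec k (λ v → sumBy (λ a → sumVec j (λ u → f (a ∷ u ++ v))) allZ)
      ≡⟨ sumVec-cong k (λ v → sumVec-suc j (λ u → f (u ++ v))) ⟨
    sumVec k (λ v → sumVec (suc j) (λ u → f (u ++ v)))
      ∎
    where open ≡-Reasoning

  allZ-unique : Unique (allZ {m})
  allZ-unique = UniqueProperties.map⁺ (cong val) (allFin⁺ (2 ℕ.^ m))

  ∈-allZ : ∀ (a : Zmod m) → a ∈ allZ
  ∈-allZ ⟦ i ⟧ = ∈-map⁺ ⟦_⟧ (∈-allFin i)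

  sumVec-unique : ∀ k (f : Vec (Zmod m) k → ℕ) v₀ → (∀ v → v ≢ v₀ → f v ≡ 0) → sumVec k f ≡ f v₀
  sumVec-unique zero    f []        _   = ℕ.+-identityʳ (f [])
  sumVec-unique (suc k) f (a₀ ∷ v₀) f≡0 = begin
    sumVec (suc k) f                            ≡⟨ sumVec-suc k f ⟩
    sumBy (λ a → sumVec k (f ∘ (a ∷_))) allZ    ≡⟨ sumBy-unique allZ-unique (∈-allZ a₀) off-a₀ ⟩
    sumVec k (f ∘ (a₀ ∷_))                      ≡⟨ sumVec-unique k (f ∘ (a₀ ∷_)) v₀ off-v₀ ⟩
    f (a₀ ∷ v₀)                                 ∎
    where
    open ≡-Reasoning
    off-a₀ : ∀ a → a ≢ a₀ → sumVec k (f ∘ (a ∷_)) ≡ 0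
    off-a₀ a a≢a₀ = sumBy-zero (All.universal (λ v → f≡0 (a ∷ v) (a≢a₀ ∘ Vec.∷-injectiveˡ)) (allVecs k))
    off-v₀ : ∀ v → v ≢ v₀ → f (a₀ ∷ v) ≡ 0
    off-v₀ v v≢v₀ = f≡0 (a₀ ∷ v) (v≢v₀ ∘ Vec.∷-injectiveʳ)

  sumVec-indicator-unique : ∀ k {P : Vec (Zmod m) k → Set} (P? : ∀ v → Dec (P v)) v₀ → P v₀ → (∀ v → P v → v ≡ v₀) →
                 sumVec k (indicator ∘ P?) ≡ 1
  sumVec-indicator-unique k P? v₀ Pv₀ P⇒≡v₀ =
    trans (sumVec-unique k (indicator ∘ P?) v₀ (λ v v≢v₀ → indicator-no (P? v) (v≢v₀ ∘ P⇒≡v₀ v)))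
          (indicator-yes (P? v₀) Pv₀)

  sumVec-indicator-none : ∀ k {P : Vec (Zmod m) k → Set} (P? : ∀ v → Dec (P v)) → (∀ v → ¬ P v) →
               sumVec k (indicator ∘ P?) ≡ 0
  sumVec-indicator-none k P? ¬P = sumBy-zero (All.universal (λ v → indicator-no (P? v) (¬P v)) (allVecs k))

  count-Δ₃ : ∀ (e₁₁ e₁₂ e₂₁ e₂₂ : Zmod m) → det (e₁₁ , e₁₂ , e₂₁ , e₂₂) ≡ 1ₘ →
             sumVec 3 (indicator ∘ inΔ? (e₁₁ , e₁₂ , e₂₁ , e₂₂)) ≡ indicator (invertible? e₂₂)
  count-Δ₃ e₁₁ e₁₂ e₂₁ e₂₂ det≡1 with invertible? e₂₂
  ... | yes e₂₂-inv = count-solution (Mk₃-surjective e₁₁ e₁₂ e₂₁ e₂₂ det≡1 e₂₂-inv)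
    where
    count-solution : Σ (Vec (Zmod m) 3) (InΔ (e₁₁ , e₁₂ , e₂₁ , e₂₂)) →
                     sumVec 3 (indicator ∘ inΔ? (e₁₁ , e₁₂ , e₂₁ , e₂₂)) ≡ 1
    count-solution (v₀@(x₀ ∷ y₀ ∷ z₀ ∷ []) , v₀∈Δ@(Mk₀≡E , _)) =
      sumVec-indicator-unique 3 (inΔ? (e₁₁ , e₁₂ , e₂₁ , e₂₂)) v₀ v₀∈Δ unique
      where
      unique : ∀ v → InΔ (e₁₁ , e₁₂ , e₂₁ , e₂₂) v → v ≡ v₀
      unique (x ∷ y ∷ z ∷ []) (Mk≡E , y-inv) =
        Mk₃-injective x y z x₀ y₀ z₀ y-inv (trans Mk≡E (sym Mk₀≡E))
  ... | no ¬e₂₂-inv = sumVec-indicator-none 3 (inΔ? (e₁₁ , e₁₂ , e₂₁ , e₂₂)) no-solution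
    where
    no-solution : ∀ v → ¬ InΔ (e₁₁ , e₁₂ , e₂₁ , e₂₂) v
    no-solution (x ∷ y ∷ z ∷ []) (Mk≡E , y-inv) =
      ¬e₂₂-inv (subst Invertible -y≡e₂₂ (-ₘ-invertible y y-inv))
      where
      -y≡e₂₂ : -ₘ y ≡ e₂₂
      -y≡e₂₂ = proj₂ (proj₂ (proj₂ (mat-≡⁻¹ (trans (sym (Mk₃ x y z)) Mk≡E))))

-- Reduction modulo 2

odd⇒¬2∣ : ∀ {n} → parity n ≡ 1ℙ → ¬ 2 ∣ n
odd⇒¬2∣ {n} odd (divides q n≡q*2) = ℙ.p≢p⁻¹ 0ℙ (begin
  0ℙ                       ≡⟨ ℙ.*-zeroʳ (parity q) ⟨
  parity q ℙ.* parity 2    ≡⟨ *-homo-* q 2 ⟨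
  parity (q ℕ.* 2)         ≡⟨ cong parity n≡q*2 ⟨
  parity n                 ≡⟨ odd ⟩
  1ℙ                       ∎)
  where open ≡-Reasoning

odd-coprime-2^ : ∀ {n} k → parity n ≡ 1ℙ → Coprime n (2 ℕ.^ k)
odd-coprime-2^ zero    odd (_ , d∣1) = ∣1⇒≡1 d∣1
odd-coprime-2^ (suc k) odd {d} (d∣n , d∣2*2^k) =
  odd-coprime-2^ k odd (d∣n , coprime-divisor coprime-d-2 d∣2*2^k)
  where
  coprime-d-2 : Coprime d 2
  coprime-d-2 {e} (e∣d , e∣2) with irreducible[2] e∣2
  ... | inj₁ e≡1 = e≡1
  ... | inj₂ refl = contradiction (∣-trans e∣d d∣n) (odd⇒¬2∣ odd)

oddIndicator : Parity → ℕ
oddIndicator 0ℙ = 0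
oddIndicator 1ℙ = 1

module _ {m : ℕ} where

  private instance
    2^1+m≢0 : NonZero (2 ℕ.^ suc m)
    2^1+m≢0 = 2^m-nonZero {suc m}

  π : Zmod (suc m) → Parity
  π a = parity (toℕₘ a)

  π-red : ∀ x → π (red x) ≡ parity x
  π-red x = begin
    parity (toℕₘ (red {suc m} x))          ≡⟨ cong parity (toℕₘ-red {suc m} x) ⟩
    parity r                               ≡⟨ ℙ.+-identityʳ (parity r) ⟨
    parity r ℙ.+ 0ℙ                        ≡⟨ cong (parity r ℙ.+_) q*2^1+m-even ⟨
    parity r ℙ.+ parity (q ℕ.* 2 ℕ.^ suc m) ≡⟨ +-homo-+ r (q ℕ.* 2 ℕ.^ suc m) ⟨
    parity (r ℕ.+ q ℕ.* 2 ℕ.^ suc m)        ≡⟨ cong parity (m≡m%n+[m/n]*n x (2 ℕ.^ suc m)) ⟨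
    parity x                               ∎
    where
    open ≡-Reasoning
    r q : ℕ
    r = x % 2 ℕ.^ suc m
    q = x / 2 ℕ.^ suc m
    q*2^1+m-even : parity (q ℕ.* 2 ℕ.^ suc m) ≡ 0ℙ
    q*2^1+m-even = begin
      parity (q ℕ.* (2 ℕ.* 2 ℕ.^ m))           ≡⟨ *-homo-* q (2 ℕ.* 2 ℕ.^ m) ⟩
      parity q ℙ.* parity (2 ℕ.* 2 ℕ.^ m)      ≡⟨ cong (parity q ℙ.*_) (*-homo-* 2 (2 ℕ.^ m)) ⟩
      parity q ℙ.* 0ℙ                          ≡⟨ ℙ.*-zeroʳ (parity q) ⟩
      0ℙ                                       ∎

  π-+ₘ : ∀ (a b : Zmod (suc m)) → π (a +ₘ b) ≡ π a ℙ.+ π b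
  π-+ₘ a b = trans (π-red _) (+-homo-+ (toℕₘ a) (toℕₘ b))

  π-*ₘ : ∀ (a b : Zmod (suc m)) → π (a *ₘ b) ≡ π a ℙ.* π b
  π-*ₘ a b = trans (π-red _) (*-homo-* (toℕₘ a) (toℕₘ b))

  π-0ₘ : π 0ₘ ≡ 0ℙ
  π-0ₘ = π-red 0

  π-1ₘ : π 1ₘ ≡ 1ℙ
  π-1ₘ = π-red 1

  π--ₘ : ∀ (a : Zmod (suc m)) → π (-ₘ a) ≡ π a
  π--ₘ a = ℙRing.+-inverseˡ-unique (π (-ₘ a)) (π a) (begin
    π (-ₘ a) ℙ.+ π a    ≡⟨ π-+ₘ (-ₘ a) a ⟨
    π (-ₘ a +ₘ a)       ≡⟨ cong π (trans (+ₘ-comm (-ₘ a) a) (-ₘ-inverseʳ a)) ⟩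
    π 0ₘ                ≡⟨ π-0ₘ ⟩
    0ℙ                  ∎)
    where open ≡-Reasoning

  invertible⇒odd : ∀ (a : Zmod (suc m)) → Invertible a → π a ≡ 1ℙ
  invertible⇒odd a (b , ab≡1) = factor-odd (π a) (π b) (begin
    π a ℙ.* π b   ≡⟨ π-*ₘ a b ⟨
    π (a *ₘ b)    ≡⟨ cong π ab≡1 ⟩
    π 1ₘ          ≡⟨ π-1ₘ ⟩
    1ℙ            ∎)
    where
    open ≡-Reasoning
    factor-odd : ∀ p q → p ℙ.* q ≡ 1ℙ → p ≡ 1ℙ
    factor-odd 1ℙ _ _ = refl

  odd⇒invertible : ∀ (a : Zmod (suc m)) → π a ≡ 1ℙ → Invertible a
  odd⇒invertible a odd with coprime-Bézout (odd-coprime-2^ (suc m) odd)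
  ... | Bézout.+- x y 1+y*2^1+m≡x*a = red x , (begin
    a *ₘ red x                          ≡⟨ *ₘ-red a x ⟩
    red (x ℕ.* toℕₘ a)                  ≡⟨ cong red 1+y*2^1+m≡x*a ⟨
    red (1 ℕ.+ y ℕ.* 2 ℕ.^ suc m)       ≡⟨ red-+ 1 _ ⟩
    1ₘ +ₘ red (y ℕ.* 2 ℕ.^ suc m)       ≡⟨ cong (1ₘ +ₘ_) (red-*2^m y) ⟩
    1ₘ +ₘ 0ₘ                            ≡⟨ +ₘ-identityʳ 1ₘ ⟩
    1ₘ                                  ∎)
    where open ≡-Reasoning
  ... | Bézout.-+ x y 1+x*a≡y*2^1+m = -ₘ red x , (begin
    a *ₘ -ₘ red x       ≡⟨ -‿distribʳ-* a (red x) ⟨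
    -ₘ (a *ₘ red x)     ≡⟨ cong -ₘ_ (+-inverseʳ-unique 1ₘ (a *ₘ red x) 1+a*x≡0) ⟩
    -ₘ -ₘ 1ₘ            ≡⟨ -‿involutive 1ₘ ⟩
    1ₘ                  ∎)
    where
    open ≡-Reasoning
    1+a*x≡0 : 1ₘ +ₘ a *ₘ red x ≡ 0ₘ
    1+a*x≡0 = begin
      1ₘ +ₘ a *ₘ red x              ≡⟨ cong (1ₘ +ₘ_) (*ₘ-red a x) ⟩
      red 1 +ₘ red (x ℕ.* toℕₘ a)   ≡⟨ red-+ 1 _ ⟨
      red (1 ℕ.+ x ℕ.* toℕₘ a)      ≡⟨ cong red 1+x*a≡y*2^1+m ⟩
      red (y ℕ.* 2 ℕ.^ suc m)       ≡⟨ red-*2^m y ⟩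
      0ₘ                            ∎

  indicator-invertible : ∀ (a : Zmod (suc m)) → indicator (invertible? a) ≡ oddIndicator (π a)
  indicator-invertible a with π a in πa
  ... | 0ℙ = indicator-no (invertible? a) (λ inv → ℙ.p≢p⁻¹ 0ℙ (trans (sym πa) (invertible⇒odd a inv)))
  ... | 1ℙ = indicator-yes (invertible? a) (odd⇒invertible a πa)

sum-tabulate-parity : ∀ n (G : Parity → ℕ) →
                      sum (List.tabulate {n = n ℕ.* 2} (G ∘ parity ∘ toℕ)) ≡ n ℕ.* (G 0ℙ ℕ.+ G 1ℙ)
sum-tabulate-parity zero    G = refl
sum-tabulate-parity (suc n) G = trans (sym (ℕ.+-assoc (G 0ℙ) (G 1ℙ) _))
                                      (cong (G 0ℙ ℕ.+ G 1ℙ ℕ.+_) (sum-tabulate-parity n G))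

sumℙ : ∀ k → (Vec Parity k → ℕ) → ℕ
sumℙ zero    G = G []
sumℙ (suc k) G = sumℙ k (G ∘ (0ℙ ∷_)) ℕ.+ sumℙ k (G ∘ (1ℙ ∷_))

module _ {m : ℕ} where

  sumBy-π : ∀ (G : Parity → ℕ) → sumBy (G ∘ π) (allZ {suc m}) ≡ 2 ℕ.^ m ℕ.* (G 0ℙ ℕ.+ G 1ℙ)
  sumBy-π G = begin
    sumBy (G ∘ π) (List.map (⟦_⟧ {suc m}) (List.allFin (2 ℕ.^ suc m)))
      ≡⟨ sumBy-map (G ∘ π) (⟦_⟧ {suc m}) (List.allFin (2 ℕ.^ suc m)) ⟩
    sum (List.map (G ∘ parity ∘ toℕ) (List.allFin (2 ℕ.^ suc m)))
      ≡⟨ cong sum (List.map-tabulate {n = 2 ℕ.^ suc m} id (G ∘ parity ∘ toℕ)) ⟩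
    sum (List.tabulate {n = 2 ℕ.* 2 ℕ.^ m} (G ∘ parity ∘ toℕ))
      ≡⟨ cong (λ n → sum (List.tabulate {n = n} (G ∘ parity ∘ toℕ))) (ℕ.*-comm 2 (2 ℕ.^ m)) ⟩
    sum (List.tabulate {n = 2 ℕ.^ m ℕ.* 2} (G ∘ parity ∘ toℕ))
      ≡⟨ sum-tabulate-parity (2 ℕ.^ m) G ⟩
    2 ℕ.^ m ℕ.* (G 0ℙ ℕ.+ G 1ℙ)
      ∎
    where open ≡-Reasoning

  sumVec-π : ∀ k (G : Vec Parity k → ℕ) →
             sumVec {suc m} k (G ∘ Vec.map π) ≡ 2 ℕ.^ (m ℕ.* k) ℕ.* sumℙ k G
  sumVec-π zero    G = cong (λ e → 2 ℕ.^ e ℕ.* G []) (sym (ℕ.*-zeroʳ m))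
  sumVec-π (suc k) G = begin
    sumVec {suc m} (suc k) (G ∘ Vec.map π)
      ≡⟨ sumVec-suc {suc m} k (G ∘ Vec.map π) ⟩
    sumBy (λ a → sumVec k (G ∘ (π a ∷_) ∘ Vec.map π)) (allZ {suc m})
      ≡⟨ sumBy-cong (allZ {suc m}) (λ a → sumVec-π k (G ∘ (π a ∷_))) ⟩
    sumBy (H ∘ π) (allZ {suc m})
      ≡⟨ sumBy-π H ⟩
    2 ℕ.^ m ℕ.* (H 0ℙ ℕ.+ H 1ℙ)
      ≡⟨ cong (2 ℕ.^ m ℕ.*_) (ℕ.*-distribˡ-+ (2 ℕ.^ (m ℕ.* k)) _ _) ⟨
    2 ℕ.^ m ℕ.* (2 ℕ.^ (m ℕ.* k) ℕ.* sumℙ (suc k) G)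
      ≡⟨ ℕ.*-assoc (2 ℕ.^ m) _ _ ⟨
    2 ℕ.^ m ℕ.* 2 ℕ.^ (m ℕ.* k) ℕ.* sumℙ (suc k) G
      ≡⟨ cong (ℕ._* sumℙ (suc k) G) (ℕ.^-distribˡ-+-* 2 m (m ℕ.* k)) ⟨
    2 ℕ.^ (m ℕ.+ m ℕ.* k) ℕ.* sumℙ (suc k) G
      ≡⟨ cong (λ e → 2 ℕ.^ e ℕ.* sumℙ (suc k) G) (ℕ.*-suc m k) ⟨
    2 ℕ.^ (m ℕ.* suc k) ℕ.* sumℙ (suc k) G
      ∎
    where
    open ≡-Reasoning
    H : Parity → ℕ
    H p = 2 ℕ.^ (m ℕ.* k) ℕ.* sumℙ k (G ∘ (p ∷_))

-- Counting through parities

-- column c u: the parities of the first column of Mk u · C when those of C are c;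
-- corner β c: the parity of the (2,2) entry of adj C · B when those of B's second column are β.
step : Parity → Parity × Parity → Parity × Parity
step a (s , t) = ((a ℙ.* s) ℙ.+ t , s)

column : ∀ {k} → Parity × Parity → Vec Parity k → Parity × Parity
column c []      = c
column c (a ∷ u) = column (step a c) u

corner : Parity × Parity → Parity × Parity → Parity
corner (β₁₂ , β₂₂) (s , t) = (t ℙ.* β₁₂) ℙ.+ (s ℙ.* β₂₂)

oddCornerCount : Parity × Parity → ℕ → Parity × Parity → ℕ
oddCornerCount β k c = sumℙ k (oddIndicator ∘ corner β ∘ column c)

module _ {m : ℕ} where

  firstColumnParity : Mat {suc m} → Parity × Parity
  firstColumnParity (a , _ , c , _) = (π a , π c)

  secondColumnParity : Mat {suc m} → Parity × Parity
  secondColumnParity (_ , b , _ , d) = (π b , π d)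

  firstColumnParity-elem-· : ∀ a (A : Mat {suc m}) →
                             firstColumnParity (elem a · A) ≡ step (π a) (firstColumnParity A)
  firstColumnParity-elem-· a A@(p , q , r , s) = begin
    firstColumnParity (elem a · A)        ≡⟨ cong firstColumnParity (elem-· a p q r s) ⟩
    (π (a *ₘ p -ₘ r) , π p)               ≡⟨ cong (_, π p) (π-+ₘ (a *ₘ p) (-ₘ r)) ⟩
    (π (a *ₘ p) ℙ.+ π (-ₘ r) , π p)       ≡⟨ cong (_, π p) (cong₂ ℙ._+_ (π-*ₘ a p) (π--ₘ r)) ⟩
    ((π a ℙ.* π p) ℙ.+ π r , π p)         ∎
    where open ≡-Reasoning

  firstColumnParity-Macc : ∀ {k} (A : Mat {suc m}) (v : Vec (Zmod (suc m)) k) →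
                           firstColumnParity (Macc A v) ≡ column (firstColumnParity A) (Vec.map π v)
  firstColumnParity-Macc A []      = refl
  firstColumnParity-Macc A (a ∷ v) = trans (firstColumnParity-Macc (elem a · A) v)
                                           (cong (λ c → column c (Vec.map π v)) (firstColumnParity-elem-· a A))

  firstColumnParity-Mk : ∀ {k} (v : Vec (Zmod (suc m)) k) →
                         firstColumnParity (Mk v) ≡ column (1ℙ , 0ℙ) (Vec.map π v)
  firstColumnParity-Mk v = trans (firstColumnParity-Macc Id v)
                                 (cong (λ c → column c (Vec.map π v)) (cong₂ _,_ (π-1ₘ {m}) (π-0ₘ {m})))

  count-Δ₃-adj : ∀ (C B : Mat {suc m}) → det C ≡ 1ₘ → det B ≡ 1ₘ →
                 sumVec 3 (indicator ∘ inΔ? (adj C · B)) ≡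
                 oddIndicator (corner (secondColumnParity B) (firstColumnParity C))
  count-Δ₃-adj C@(c₁₁ , c₁₂ , c₂₁ , c₂₂) B@(b₁₁ , b₁₂ , b₂₁ , b₂₂) det-C det-B = begin
    sumVec 3 (indicator ∘ inΔ? (adj C · B))    ≡⟨ count-Δ₃ _ _ _ _ det-adj·B ⟩
    indicator (invertible? e₂₂)               ≡⟨ indicator-invertible e₂₂ ⟩
    oddIndicator (π e₂₂)                      ≡⟨ cong oddIndicator π-e₂₂ ⟩
    oddIndicator ((π c₂₁ ℙ.* π b₁₂) ℙ.+ (π c₁₁ ℙ.* π b₂₂)) ∎
    where
    open ≡-Reasoning
    e₂₂ : Zmod (suc m)
    e₂₂ = -ₘ c₂₁ *ₘ b₁₂ +ₘ c₁₁ *ₘ b₂₂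
    det-adj·B : det (adj C · B) ≡ 1ₘ
    det-adj·B = begin
      det (adj C · B)        ≡⟨ det-· (adj C) B ⟩
      det (adj C) *ₘ det B   ≡⟨ cong₂ _*ₘ_ (trans (det-adj C) det-C) det-B ⟩
      1ₘ *ₘ 1ₘ               ≡⟨ *ₘ-identityˡ 1ₘ ⟩
      1ₘ                     ∎
    π-e₂₂ : π e₂₂ ≡ (π c₂₁ ℙ.* π b₁₂) ℙ.+ (π c₁₁ ℙ.* π b₂₂)
    π-e₂₂ = begin
      π e₂₂
        ≡⟨ π-+ₘ (-ₘ c₂₁ *ₘ b₁₂) (c₁₁ *ₘ b₂₂) ⟩
      π (-ₘ c₂₁ *ₘ b₁₂) ℙ.+ π (c₁₁ *ₘ b₂₂)
        ≡⟨ cong₂ ℙ._+_ (π-*ₘ (-ₘ c₂₁) b₁₂) (π-*ₘ c₁₁ b₂₂) ⟩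
      (π (-ₘ c₂₁) ℙ.* π b₁₂) ℙ.+ (π c₁₁ ℙ.* π b₂₂)
        ≡⟨ cong (λ p → (p ℙ.* π b₁₂) ℙ.+ (π c₁₁ ℙ.* π b₂₂)) (π--ₘ c₂₁) ⟩
      (π c₂₁ ℙ.* π b₁₂) ℙ.+ (π c₁₁ ℙ.* π b₂₂)
        ∎

  cardΔ-oddCornerCount : ∀ k (B : Mat {suc m}) → det B ≡ 1ₘ →
    cardΔ (suc m) (3 ℕ.+ k) B ≡ 2 ℕ.^ (m ℕ.* k) ℕ.* oddCornerCount (secondColumnParity B) k (1ℙ , 0ℙ)
  cardΔ-oddCornerCount k B det-B = begin
    cardΔ (suc m) (3 ℕ.+ k) B
      ≡⟨ length-filter (inΔ? B) (allVecs (3 ℕ.+ k)) ⟩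
    sumVec (3 ℕ.+ k) (indicator ∘ inΔ? B)
      ≡⟨ sumVec-++ 3 k (indicator ∘ inΔ? B) ⟩
    sumVec k (λ v → sumVec 3 (λ u → indicator (inΔ? B (u ++ v))))
      ≡⟨ sumVec-cong k (λ v → sumVec-cong 3 (λ u →
           indicator-⇔ (InΔ-++ B u v) (inΔ? B (u ++ v)) (inΔ? (adj (Mk v) · B) u))) ⟩
    sumVec k (λ v → sumVec 3 (indicator ∘ inΔ? (adj (Mk v) · B)))
      ≡⟨ sumVec-cong k (λ v → count-Δ₃-adj (Mk v) B (det-Mk v) det-B) ⟩
    sumVec k (λ v → oddIndicator (corner β (firstColumnParity (Mk v))))
      ≡⟨ sumVec-cong k (λ v → cong (oddIndicator ∘ corner β) (firstColumnParity-Mk v)) ⟩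
    sumVec k (oddIndicator ∘ corner β ∘ column (1ℙ , 0ℙ) ∘ Vec.map π)
      ≡⟨ sumVec-π k (oddIndicator ∘ corner β ∘ column (1ℙ , 0ℙ)) ⟩
    2 ℕ.^ (m ℕ.* k) ℕ.* oddCornerCount β k (1ℙ , 0ℙ)
      ∎
    where
    open ≡-Reasoning
    β : Parity × Parity
    β = secondColumnParity B

-- The recurrence

record ClosedForm (β : Parity × Parity) (α : ℤ) (k : ℕ) : Set where
  field
    from-10 : + 3 * + oddCornerCount β k (1ℙ , 0ℙ) ≡ (+ 2) ^ suc k + α * (- + 1) ^ k
    from-11 : + 3 * + oddCornerCount β k (1ℙ , 1ℙ) ≡ (+ 2) ^ suc k + α * (- + 1) ^ k
    from-01 : + 3 * + oddCornerCount β k (0ℙ , 1ℙ) ≡ (+ 2) ^ suc k + - + 2 * α * (- + 1) ^ k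

-- step sends (1,0) to (0,1) and (1,1), (1,1) to (1,1) and (0,1), and (0,1) twice to (1,0).
closedForm-suc : ∀ {β α} k → ClosedForm β α k → ClosedForm β α (suc k)
closedForm-suc {β} {α} k cf = record
  { from-10 = trans (3*-+ (W (0ℙ , 1ℙ)) (W (1ℙ , 1ℙ))) (trans (cong₂ _+_ from-01 from-11) (sum₁ P α e))
  ; from-11 = trans (3*-+ (W (1ℙ , 1ℙ)) (W (0ℙ , 1ℙ))) (trans (cong₂ _+_ from-11 from-01) (sum₂ P α e))
  ; from-01 = trans (3*-+ (W (1ℙ , 0ℙ)) (W (1ℙ , 0ℙ))) (trans (cong₂ _+_ from-10 from-10) (sum₃ P α e))
  }
  where
  open ClosedForm cf
  W : Parity × Parity → ℕ
  W = oddCornerCount β k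
  P e : ℤ
  P = (+ 2) ^ suc k
  e = (- + 1) ^ k
  3*-+ : ∀ x y → + 3 * + (x ℕ.+ y) ≡ + 3 * + x + + 3 * + y
  3*-+ x y = trans (cong (+ 3 *_) (ℤ.pos-+ x y)) (ℤ.*-distribˡ-+ (+ 3) (+ x) (+ y))
  sum₁ : ∀ P α e → (P + - + 2 * α * e) + (P + α * e) ≡ + 2 * P + α * (- + 1 * e)
  sum₁ = solve-∀
  sum₂ : ∀ P α e → (P + α * e) + (P + - + 2 * α * e) ≡ + 2 * P + α * (- + 1 * e)
  sum₂ = solve-∀
  sum₃ : ∀ P α e → (P + α * e) + (P + α * e) ≡ + 2 * P + - + 2 * α * (- + 1 * e)
  sum₃ = solve-∀

closedForm : ∀ {β α} k → ClosedForm β α 1 → ClosedForm β α (suc k)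
closedForm zero    cf₁ = cf₁
closedForm (suc k) cf₁ = closedForm-suc (suc k) (closedForm k cf₁)

pos-^ : ∀ a n → + (a ℕ.^ n) ≡ (+ a) ^ n
pos-^ a zero    = refl
pos-^ a (suc n) = trans (ℤ.pos-* a (a ℕ.^ n)) (cong (+ a ℤ.*_) (pos-^ a n))

module _ {m : ℕ} where

  3*cardΔ : ∀ k (B : Mat {suc m}) α → det B ≡ 1ₘ → ClosedForm (secondColumnParity B) α k →
            + 3 * + cardΔ (suc m) (3 ℕ.+ k) B ≡ (+ 2) ^ (m ℕ.* k) * ((+ 2) ^ suc k + α * (- + 1) ^ k)
  3*cardΔ k B α det-B cf = begin
    + 3 * + cardΔ (suc m) (3 ℕ.+ k) B
      ≡⟨ cong (λ c → + 3 * + c) (cardΔ-oddCornerCount k B det-B) ⟩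
    + 3 * + (2 ℕ.^ (m ℕ.* k) ℕ.* W)
      ≡⟨ cong (+ 3 *_) (trans (ℤ.pos-* (2 ℕ.^ (m ℕ.* k)) W) (cong (_* + W) (pos-^ 2 (m ℕ.* k)))) ⟩
    + 3 * ((+ 2) ^ (m ℕ.* k) * + W)
      ≡⟨ x*[y*z]≡y*[x*z] (+ 3) ((+ 2) ^ (m ℕ.* k)) (+ W) ⟩
    (+ 2) ^ (m ℕ.* k) * (+ 3 * + W)
      ≡⟨ cong ((+ 2) ^ (m ℕ.* k) ℤ.*_) (ClosedForm.from-10 cf) ⟩
    (+ 2) ^ (m ℕ.* k) * ((+ 2) ^ suc k + α * (- + 1) ^ k)
      ∎
    where
    open ≡-Reasoning
    W : ℕ
    W = oddCornerCount (secondColumnParity B) k (1ℙ , 0ℙ)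
    x*[y*z]≡y*[x*z] : ∀ x y z → x * (y * z) ≡ y * (x * z)
    x*[y*z]≡y*[x*z] = solve-∀

-- The six matrices

module _ {m : ℕ} where

  det-negM : ∀ (A : Mat {m}) → det (negM A) ≡ det A
  det-negM (a , b , c , d) =
    solve 4 (λ a b c d → (:- a) :* (:- d) :- (:- b) :* (:- c) := a :* d :- b :* c) refl a b c d

  det-S : det (S {m}) ≡ 1ₘ
  det-S = solve 0 (con (+ 0) :* con (+ 0) :- (:- con (+ 1)) :* con (+ 1) := con (+ 1)) refl

  det-T : det (T {m}) ≡ 1ₘ
  det-T = solve 0 (con (+ 1) :* con (+ 1) :- con (+ 1) :* con (+ 0) := con (+ 1)) refl

module _ {m : ℕ} where

  secondColumnParity-negM : ∀ (A : Mat {suc m}) → secondColumnParity (negM A) ≡ secondColumnParity A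
  secondColumnParity-negM (_ , b , _ , d) = cong₂ _,_ (π--ₘ b) (π--ₘ d)

  secondColumnParity-Id : secondColumnParity (Id {suc m}) ≡ (0ℙ , 1ℙ)
  secondColumnParity-Id = cong₂ _,_ (π-0ₘ {m}) (π-1ₘ {m})

  secondColumnParity-S : secondColumnParity (S {suc m}) ≡ (1ℙ , 0ℙ)
  secondColumnParity-S = cong₂ _,_ (trans (π--ₘ (1ₘ {suc m})) (π-1ₘ {m})) (π-0ₘ {m})

  secondColumnParity-T : secondColumnParity (T {suc m}) ≡ (1ℙ , 1ℙ)
  secondColumnParity-T = cong₂ _,_ (π-1ₘ {m}) (π-1ₘ {m})

closedForm-Id : ClosedForm (0ℙ , 1ℙ) (+ 1) 1
closedForm-Id = record { from-10 = refl ; from-11 = refl ; from-01 = refl }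

closedForm-S : ClosedForm (1ℙ , 0ℙ) (- + 2) 1
closedForm-S = record { from-10 = refl ; from-11 = refl ; from-01 = refl }

closedForm-T : ClosedForm (1ℙ , 1ℙ) (+ 1) 1
closedForm-T = record { from-10 = refl ; from-11 = refl ; from-01 = refl }

scaledCardΔ : (m n : ℕ) → Mat {m} → ℤ
scaledCardΔ m n B = + 3 * (+ 2) ^ (n ℕ.+ 3 ℕ.* m) * + cardΔ m n B

scaledCardΔ-closedForm : ∀ μ k (B : Mat {suc μ}) {β α} → det B ≡ 1ₘ → secondColumnParity B ≡ β →
  ClosedForm β α 1 →
  scaledCardΔ (suc μ) (4 ℕ.+ k) B ≡
  (+ 2) ^ (suc μ ℕ.* (4 ℕ.+ k)) * (+ 8 * ((+ 2) ^ (2 ℕ.+ k) + α * (- + 1) ^ suc k))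
scaledCardΔ-closedForm μ k B {β} {α} det-B β-B cf₁ = begin
  + 3 * 2^ a * + cardΔ (suc μ) n B   ≡⟨ x*y*z≡y*[x*z] (+ 3) (2^ a) (+ cardΔ (suc μ) n B) ⟩
  2^ a * (+ 3 * + cardΔ (suc μ) n B) ≡⟨ cong (2^ a *_) (3*cardΔ (suc k) B α det-B cf) ⟩
  2^ a * (2^ (μ ℕ.* suc k) * R)      ≡⟨ ℤ.*-assoc (2^ a) (2^ (μ ℕ.* suc k)) R ⟨
  2^ a * 2^ (μ ℕ.* suc k) * R        ≡⟨ cong (_* R) (ℤ.^-distribˡ-+-* (+ 2) a (μ ℕ.* suc k)) ⟨
  2^ (a ℕ.+ μ ℕ.* suc k) * R         ≡⟨ cong (λ e → 2^ e * R) (exponent μ k) ⟩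
  2^ (suc μ ℕ.* n ℕ.+ 3) * R         ≡⟨ cong (_* R) (ℤ.^-distribˡ-+-* (+ 2) (suc μ ℕ.* n) 3) ⟩
  2^ (suc μ ℕ.* n) * + 8 * R         ≡⟨ ℤ.*-assoc (2^ (suc μ ℕ.* n)) (+ 8) R ⟩
  2^ (suc μ ℕ.* n) * (+ 8 * R)       ∎
  where
  open ≡-Reasoning
  2^_ : ℕ → ℤ
  2^ e = (+ 2) ^ e
  n a : ℕ
  n = 4 ℕ.+ k
  a = n ℕ.+ 3 ℕ.* suc μ
  R : ℤ
  R = (+ 2) ^ (2 ℕ.+ k) + α * (- + 1) ^ suc k
  cf : ClosedForm (secondColumnParity B) α (suc k)
  cf = closedForm k (subst (λ β → ClosedForm β α 1) (sym β-B) cf₁)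
  x*y*z≡y*[x*z] : ∀ x y z → x * y * z ≡ y * (x * z)
  x*y*z≡y*[x*z] = solve-∀
  exponent : ∀ μ k → 4 ℕ.+ k ℕ.+ 3 ℕ.* suc μ ℕ.+ μ ℕ.* suc k ≡ suc μ ℕ.* (4 ℕ.+ k) ℕ.+ 3
  exponent = ℕ-solve-∀

scaledCardΔ±-closedForm : ∀ μ k (B : Mat {suc μ}) {β α r} → det B ≡ 1ₘ → secondColumnParity B ≡ β →
  ClosedForm β α 1 →
  (+ 2) ^ (suc μ ℕ.* (4 ℕ.+ k)) * (+ 8 * ((+ 2) ^ (2 ℕ.+ k) + α * (- + 1) ^ suc k)) ≡ r →
  scaledCardΔ (suc μ) (4 ℕ.+ k) B ≡ r × scaledCardΔ (suc μ) (4 ℕ.+ k) (negM B) ≡ r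
scaledCardΔ±-closedForm μ k B det-B β-B cf₁ ≡r =
    trans (scaledCardΔ-closedForm μ k B det-B β-B cf₁) ≡r
  , trans (scaledCardΔ-closedForm μ k (negM B) (trans (det-negM B) det-B) (trans (secondColumnParity-negM B) β-B) cf₁) ≡r

closedForm≡rId : ∀ m k → let n = 4 ℕ.+ k in
  (+ 2) ^ (m ℕ.* n) * (+ 8 * ((+ 2) ^ (2 ℕ.+ k) + + 1 * (- + 1) ^ suc k)) ≡
  (+ 2) ^ (m ℕ.* n) * ((+ 2) ^ (n ℕ.+ 1) + + 8 * (- + 1) ^ (n ℕ.+ 1))
closedForm≡rId m k = trans (ring ((+ 2) ^ (m ℕ.* (4 ℕ.+ k))) ((+ 2) ^ suc k) ((- + 1) ^ suc k))
  (cong (λ p → (+ 2) ^ (m ℕ.* (4 ℕ.+ k)) * ((+ 2) ^ p + + 8 * (- + 1) ^ p)) (ℕ.+-comm 1 (4 ℕ.+ k)))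
  where
  ring : ∀ Y X e → Y * (+ 8 * (+ 2 * X + + 1 * e)) ≡
                   Y * (+ 2 * (+ 2 * (+ 2 * (+ 2 * X))) + + 8 * (- + 1 * (- + 1 * (- + 1 * (- + 1 * e)))))
  ring = solve-∀

closedForm≡rS : ∀ m k → let n = 4 ℕ.+ k in
  (+ 2) ^ (m ℕ.* n) * (+ 8 * ((+ 2) ^ (2 ℕ.+ k) + - + 2 * (- + 1) ^ suc k)) ≡
  (+ 2) ^ (m ℕ.* n ℕ.+ 1) * ((+ 2) ^ n + (- + 1) ^ n * + 8)
closedForm≡rS m k = trans (ring ((+ 2) ^ (m ℕ.* (4 ℕ.+ k))) ((+ 2) ^ suc k) ((- + 1) ^ suc k))
  (cong (_* ((+ 2) ^ (4 ℕ.+ k) + (- + 1) ^ (4 ℕ.+ k) * + 8)) (sym (ℤ.^-distribˡ-+-* (+ 2) (m ℕ.* (4 ℕ.+ k)) 1)))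
  where
  ring : ∀ Y X e → Y * (+ 8 * (+ 2 * X + - + 2 * e)) ≡
                   Y * (+ 2 * + 1) * (+ 2 * (+ 2 * (+ 2 * X)) + - + 1 * (- + 1 * (- + 1 * e)) * + 8)
  ring = solve-∀

corollary2p5 : (m n : ℕ) → 2 ≤ m → 4 < n →
  let lhs : ℕ → ℤ
      lhs c = + 3 * (+ 2) ^ (n Data.Nat.+ 3 Data.Nat.* m) * + c
      rId : ℤ
      rId = (+ 2) ^ (m Data.Nat.* n) * ((+ 2) ^ (n Data.Nat.+ 1) + + 8 * (- + 1) ^ (n Data.Nat.+ 1))
      rS : ℤ
      rS = (+ 2) ^ (m Data.Nat.* n Data.Nat.+ 1) * ((+ 2) ^ n + (- + 1) ^ n * + 8)
  in (lhs (cardΔ m n Id) ≡ rId) × (lhs (cardΔ m n (negM Id)) ≡ rId)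
   × (lhs (cardΔ m n S) ≡ rS) × (lhs (cardΔ m n (negM S)) ≡ rS)
   × (lhs (cardΔ m n T) ≡ rId) × (lhs (cardΔ m n (negM T)) ≡ rId)
corollary2p5 (suc μ) (suc (suc (suc (suc (suc k))))) (s≤s _) (s≤s (s≤s (s≤s (s≤s (s≤s _))))) =
  let (Id₁ , Id₂) = scaledCardΔ±-closedForm μ (suc k) Id det-Id (secondColumnParity-Id {μ}) closedForm-Id
                      (closedForm≡rId (suc μ) (suc k))
      (S₁ , S₂)   = scaledCardΔ±-closedForm μ (suc k) S det-S (secondColumnParity-S {μ}) closedForm-S
                      (closedForm≡rS (suc μ) (suc k))
      (T₁ , T₂)   = scaledCardΔ±-closedForm μ (suc k) T det-T (secondColumnParity-T {μ}) closedForm-T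
                      (closedForm≡rId (suc μ) (suc k))
  in Id₁ , Id₂ , S₁ , S₂ , T₁ , T₂
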